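{- There is no Zumkeller number of the form $p_1^{\alpha}p_2^{\beta}$ where $p_1,p_2$ are distinct odd primes and $\alpha,\beta$ are positive integers.
   Context: A positive integer $n$ is a Zumkeller number if the set of its positive divisors can be partitioned into two disjoint subsets with equal sums. -}

module Defs where

open import Data.Nat using (ℕ; suc; _>_)
open import Data.Nat.Divisibility using (_∣?_)
open import Data.List using (List; filter; applyUpTo)
open import Data.Nat.ListAction using (sum)
open import Relation.Nullary.Decidable using (T?)
open import Data.Bool using (Bool; true; false; T; not)
open import Data.Product using (Σ; _×_)
open import Relation.Binary.PropositionalEquality using (_≡_)

divisors : ℕ → List ℕ
divisors n = filter (_∣? n) (applyUpTo suc n)

-- A partition of the divisor set into two disjoint subsets A and B is given
-- by a membership indicator: d ∈ A iff inA d ≡ true, otherwise d ∈ B.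
sumIn : (ℕ → Bool) → List ℕ → ℕ
sumIn inA ds = sum (filter (λ d → T? (inA d)) ds)

Zumkeller : ℕ → Set
Zumkeller n = (n > 0) × Σ (ℕ → Bool) (λ inA →
  sumIn inA (divisors n) ≡ sumIn (λ d → not (inA d)) (divisors n))

module Submission where

-- Write σ(n) for the sum of the divisors of n.  The proof shows that
-- n = p^α q^β, with p ≠ q odd primes, is deficient (σ(n) < 2n), whereas
-- every Zumkeller number satisfies 2n ≤ σ(n).
--
--  1. Zumkeller ⇒ 2n ≤ σ(n): the divisor n lies in one of the two halves,
--     and each half sums to σ(n)/2.
--  2. σ(p^a q^b) ≤ (1 + … + p^a)(1 + … + q^b) for primes p, q: every
--     divisor is some p^i q^j with i ≤ a, j ≤ b, and the divisor list is
--     duplicate-free, so its sum is at most that of the list of all products.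
--  3. The geometric sum gives (p-1)(1 + … + p^a) < p^(a+1), so the bound in
--     step 2 is below n·pq/((p-1)(q-1)), and pq ≤ 2(p-1)(q-1) whenever p, q
--     are distinct and at least 3.

open import Defs
open import Data.Nat using (ℕ; zero; suc; _+_; _*_; _^_; _≤_; _<_; _>_; z≤n; s≤s; NonZero)
open import Data.Nat.Properties
open import Data.Nat.Divisibility using (_∣_; _∣?_; divides; ∣-refl; *-cancelˡ-∣; ∣1⇒≡1)
open import Data.Nat.Primality using (Prime; prime⇒irreducible; prime⇒nonZero; prime⇒nonTrivial)
open import Data.Nat.Coprimality using (Coprime; coprime-divisor)
open import Data.Nat.ListAction using (sum)
open import Data.Nat.ListAction.Properties using (sum-++; sum-↭)
open import Data.Nat.Tactic.RingSolver using (solve-∀)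
open import Data.List using (List; []; _∷_; _++_; map; applyUpTo; cartesianProductWith)
open import Data.List.Membership.Propositional using (_∈_)
open import Data.List.Membership.Propositional.Properties
  using (∈-filter⁺; ∈-filter⁻; ∈-applyUpTo⁺; ∈-map⁺; ∈-cartesianProductWith⁺; ∈-∃++; ∈-++⁻; ∈-++⁺ˡ; ∈-++⁺ʳ)
open import Data.List.Relation.Binary.Permutation.Propositional using (↭-sym)
open import Data.List.Relation.Binary.Permutation.Propositional.Properties using (shift)
open import Data.List.Relation.Unary.Any using (here; there)
open import Data.List.Relation.Unary.All as All using ()
open import Data.List.Relation.Unary.Unique.Propositional using (Unique; _∷_)
import Data.List.Relation.Unary.Unique.Propositional.Properties as Unique
open import Data.Bool using (Bool; true; false; not; T)
open import Data.Unit using (tt)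
open import Data.Product using (∃; ∃₂; _×_; _,_; proj₂)
open import Data.Sum using (_⊎_; inj₁; inj₂)
open import Data.Empty using (⊥-elim)
open import Function using (_∘_)
open import Relation.Nullary using (¬_; yes; no)
open import Relation.Nullary.Decidable using (T?)
open import Relation.Binary.PropositionalEquality
  using (_≡_; _≢_; refl; sym; trans; cong; cong₂; subst; subst₂; module ≡-Reasoning)

sumIn-complement : (f : ℕ → Bool) (xs : List ℕ) →
                   sumIn f xs + sumIn (λ d → not (f d)) xs ≡ sum xs
sumIn-complement f [] = refl
sumIn-complement f (x ∷ xs) with f x
... | true  = trans (+-assoc x _ _) (cong (x +_) (sumIn-complement f xs))
... | false = trans (+-comm (sumIn f xs) (x + _))
                (trans (+-assoc x _ _)
                  (cong (x +_) (trans (+-comm _ (sumIn f xs)) (sumIn-complement f xs))))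

∈⇒≤sum : ∀ {x xs} → x ∈ xs → x ≤ sum xs
∈⇒≤sum {xs = y ∷ ys} (here refl) = m≤m+n y (sum ys)
∈⇒≤sum {xs = y ∷ ys} (there x∈ys) = ≤-trans (∈⇒≤sum x∈ys) (m≤n+m (sum ys) y)

∈⇒≤sumIn-part : (f : ℕ → Bool) {x : ℕ} {xs : List ℕ} → x ∈ xs →
                x ≤ sumIn f xs ⊎ x ≤ sumIn (λ d → not (f d)) xs
∈⇒≤sumIn-part f {x} x∈xs with f x in fx
... | true  = inj₁ (∈⇒≤sum (∈-filter⁺ (λ d → T? (f d)) x∈xs (subst T (sym fx) tt)))
... | false = inj₂ (∈⇒≤sum (∈-filter⁺ (λ d → T? (not (f d))) x∈xs (subst (T ∘ not) (sym fx) tt)))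

balanced⇒2*member≤sum : (f : ℕ → Bool) {x : ℕ} {xs : List ℕ} →
                        sumIn f xs ≡ sumIn (λ d → not (f d)) xs → x ∈ xs →
                        2 * x ≤ sum xs
balanced⇒2*member≤sum f {x} {xs} balanced x∈xs = subst (2 * x ≤_) total (*-monoʳ-≤ 2 x≤half)
  where
  half = sumIn f xs
  x≤half : x ≤ half
  x≤half with ∈⇒≤sumIn-part f x∈xs
  ... | inj₁ x≤A = x≤A
  ... | inj₂ x≤B = subst (x ≤_) (sym balanced) x≤B
  total : 2 * half ≡ sum xs
  total = begin
    half + (half + 0)   ≡⟨ cong (half +_) (+-identityʳ half) ⟩
    half + half         ≡⟨ cong (half +_) balanced ⟩
    half + sumIn (λ d → not (f d)) xs ≡⟨ sumIn-complement f xs ⟩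
    sum xs              ∎
    where open ≡-Reasoning

n∈divisors : ∀ n → n > 0 → n ∈ divisors n
n∈divisors (suc k) _ = ∈-filter⁺ (_∣? suc k) (∈-applyUpTo⁺ suc (n<1+n k)) ∣-refl

zumkeller⇒2n≤σ : ∀ {n} → Zumkeller n → 2 * n ≤ sum (divisors n)
zumkeller⇒2n≤σ {n} (n>0 , f , balanced) = balanced⇒2*member≤sum f balanced (n∈divisors n n>0)

sum-mono-⊆ : ∀ {xs} ys → Unique xs → (∀ {z} → z ∈ xs → z ∈ ys) → sum xs ≤ sum ys
sum-mono-⊆ {[]} ys _ _ = z≤n
sum-mono-⊆ {x ∷ xs} ys (x∉xs ∷ unique) xs⊆ys
  with ys₁ , ys₂ , refl ← ∈-∃++ (xs⊆ys (here refl)) = begin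
    x + sum xs              ≤⟨ +-monoʳ-≤ x (sum-mono-⊆ (ys₁ ++ ys₂) unique xs⊆rest) ⟩
    x + sum (ys₁ ++ ys₂)    ≡⟨ sum-↭ (↭-sym (shift x ys₁ ys₂)) ⟩
    sum (ys₁ ++ x ∷ ys₂)    ∎
  where
  open ≤-Reasoning
  xs⊆rest : ∀ {z} → z ∈ xs → z ∈ ys₁ ++ ys₂
  xs⊆rest z∈xs with ∈-++⁻ ys₁ (xs⊆ys (there z∈xs))
  ... | inj₁ z∈ys₁         = ∈-++⁺ˡ z∈ys₁
  ... | inj₂ (here refl)   = ⊥-elim (All.lookup x∉xs z∈xs refl)
  ... | inj₂ (there z∈ys₂) = ∈-++⁺ʳ ys₁ z∈ys₂

divisors-unique : ∀ n → Unique (divisors n)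
divisors-unique n = Unique.filter⁺ (_∣? n)
  (Unique.applyUpTo⁺₁ suc n (λ i<j _ eq → <⇒≢ i<j (suc-injective eq)))

prime∤⇒coprime : ∀ {p d} → Prime p → ¬ p ∣ d → Coprime d p
prime∤⇒coprime p-prime p∤d (c∣d , c∣p) with prime⇒irreducible p-prime c∣p
... | inj₁ c≡1 = c≡1
... | inj₂ refl = ⊥-elim (p∤d c∣d)

∣p^a*m⇒ : ∀ {p} → Prime p → ∀ a {m d} → d ∣ p ^ a * m →
          ∃₂ λ i e → i ≤ a × e ∣ m × d ≡ p ^ i * e
∣p^a*m⇒ _ zero {m} {d} d∣m = 0 , d , z≤n , subst (d ∣_) (*-identityˡ m) d∣m , sym (*-identityˡ d)
∣p^a*m⇒ {p} p-prime (suc a) {m} {d} d∣pp^am with p ∣? d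
... | yes (divides k refl)
  with i , e , i≤a , e∣m , k≡p^ie ← ∣p^a*m⇒ p-prime a
         (*-cancelˡ-∣ p {{prime⇒nonZero p-prime}}
           (subst₂ _∣_ (*-comm k p) (*-assoc p (p ^ a) m) d∣pp^am))
  = suc i , e , s≤s i≤a , e∣m , d≡
  where
  d≡ : k * p ≡ p ^ suc i * e
  d≡ = begin
    k * p           ≡⟨ cong (_* p) k≡p^ie ⟩
    p ^ i * e * p   ≡⟨ *-comm (p ^ i * e) p ⟩
    p * (p ^ i * e) ≡⟨ *-assoc p (p ^ i) e ⟨
    p ^ suc i * e   ∎
    where open ≡-Reasoning
... | no p∤d
  with i , e , i≤a , e∣m , d≡p^ie ← ∣p^a*m⇒ p-prime a
         (coprime-divisor (prime∤⇒coprime p-prime p∤d) (subst (d ∣_) (*-assoc p (p ^ a) m) d∣pp^am))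
  = i , e , m≤n⇒m≤1+n i≤a , e∣m , d≡p^ie

powers : ℕ → ℕ → List ℕ
powers p zero    = 1 ∷ []
powers p (suc a) = 1 ∷ map (p *_) (powers p a)

p^i∈powers : ∀ p {i a} → i ≤ a → p ^ i ∈ powers p a
p^i∈powers p {zero}  {zero}  _         = here refl
p^i∈powers p {zero}  {suc a} _         = here refl
p^i∈powers p {suc i} {suc a} (s≤s i≤a) = there (∈-map⁺ (p *_) (p^i∈powers p i≤a))

divisor∈products : ∀ {p q} → Prime p → Prime q → ∀ a b {d} → d ∣ p ^ a * q ^ b →
                   d ∈ cartesianProductWith _*_ (powers p a) (powers q b)
divisor∈products {p} {q} p-prime q-prime a b {d} d∣n
  with i , e , i≤a , e∣q^b , d≡p^ie ← ∣p^a*m⇒ p-prime a d∣n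
  with j , f , j≤b , f∣1 , e≡q^jf ← ∣p^a*m⇒ q-prime b (subst (e ∣_) (sym (*-identityʳ (q ^ b))) e∣q^b)
  = subst (_∈ cartesianProductWith _*_ (powers p a) (powers q b)) (sym d≡p^iq^j)
      (∈-cartesianProductWith⁺ _*_ (p^i∈powers p i≤a) (p^i∈powers q j≤b))
  where
  d≡p^iq^j : d ≡ p ^ i * q ^ j
  d≡p^iq^j = begin
    d               ≡⟨ d≡p^ie ⟩
    p ^ i * e       ≡⟨ cong (p ^ i *_) e≡q^jf ⟩
    p ^ i * (q ^ j * f) ≡⟨ cong (λ f → p ^ i * (q ^ j * f)) (∣1⇒≡1 f∣1) ⟩
    p ^ i * (q ^ j * 1) ≡⟨ cong (p ^ i *_) (*-identityʳ (q ^ j)) ⟩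
    p ^ i * q ^ j   ∎
    where open ≡-Reasoning

sum-map-* : ∀ x ys → sum (map (x *_) ys) ≡ x * sum ys
sum-map-* x []       = sym (*-zeroʳ x)
sum-map-* x (y ∷ ys) = trans (cong (x * y +_) (sum-map-* x ys)) (sym (*-distribˡ-+ x y (sum ys)))

sum-products : ∀ xs ys → sum (cartesianProductWith _*_ xs ys) ≡ sum xs * sum ys
sum-products []       ys = refl
sum-products (x ∷ xs) ys = begin
  sum (map (x *_) ys ++ cartesianProductWith _*_ xs ys)  ≡⟨ sum-++ (map (x *_) ys) _ ⟩
  sum (map (x *_) ys) + sum (cartesianProductWith _*_ xs ys)
    ≡⟨ cong₂ _+_ (sum-map-* x ys) (sum-products xs ys) ⟩
  x * sum ys + sum xs * sum ys                           ≡⟨ *-distribʳ-+ (sum ys) x (sum xs) ⟨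
  (x + sum xs) * sum ys                                  ∎
  where open ≡-Reasoning

σ-bound : ∀ {p q} → Prime p → Prime q → ∀ a b →
          sum (divisors (p ^ a * q ^ b)) ≤ sum (powers p a) * sum (powers q b)
σ-bound {p} {q} p-prime q-prime a b = subst (sum (divisors n) ≤_) (sum-products (powers p a) (powers q b))
  (sum-mono-⊆ _ (divisors-unique n)
    (λ d∈ → divisor∈products p-prime q-prime a b (proj₂ (∈-filter⁻ (_∣? n) {xs = applyUpTo suc n} d∈))))
  where n = p ^ a * q ^ b

-- Geometric sum: (p - 1)(1 + p + … + p^a) + 1 = p^(a+1), written with p = 1 + p'.
geometric-sum : ∀ p' a → p' * sum (powers (suc p') a) + 1 ≡ suc p' ^ suc a
geometric-sum p' zero    = base p'
  where
  base : ∀ p' → p' * (1 + 0) + 1 ≡ suc p' * 1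
  base = solve-∀
geometric-sum p' (suc a) = begin
  p' * (1 + sum (map (suc p' *_) G)) + 1 ≡⟨ cong (λ s → p' * (1 + s) + 1) (sum-map-* (suc p') G) ⟩
  p' * (1 + suc p' * sum G) + 1        ≡⟨ factor p' (sum G) ⟩
  suc p' * (p' * sum G + 1)            ≡⟨ cong (suc p' *_) (geometric-sum p' a) ⟩
  suc p' * suc p' ^ suc a              ∎
  where
  open ≡-Reasoning
  G = powers (suc p') a
  factor : ∀ p' s → p' * (1 + suc p' * s) + 1 ≡ suc p' * (p' * s + 1)
  factor = solve-∀

odd-prime⇒3+ : ∀ {p} → Prime p → ¬ 2 ∣ p → ∃ λ a → p ≡ 3 + a
odd-prime⇒3+ {0}           _       odd = ⊥-elim (odd (divides 0 refl))
odd-prime⇒3+ {1}           p-prime _   with () ← prime⇒nonTrivial p-prime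
odd-prime⇒3+ {2}           _       odd = ⊥-elim (odd ∣-refl)
odd-prime⇒3+ {suc (suc (suc a))} _ _   = a , refl

-- For distinct p, q ≥ 3: pq ≤ 2(p - 1)(q - 1), written with p = 3 + a, q = 3 + b.
distinct≥3⇒pq≤2[p-1][q-1] : ∀ a b → a ≢ b → (3 + a) * (3 + b) ≤ 2 * ((2 + a) * (2 + b))
distinct≥3⇒pq≤2[p-1][q-1] a b a≢b = +-cancelʳ-≤ 1 _ _ (begin
  (3 + a) * (3 + b) + 1                     ≤⟨ +-monoʳ-≤ ((3 + a) * (3 + b)) (1≤gap a b a≢b) ⟩
  (3 + a) * (3 + b) + (a * b + a + b)       ≡⟨ gap a b ⟩
  2 * ((2 + a) * (2 + b)) + 1               ∎)
  where
  open ≤-Reasoning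
  gap : ∀ a b → (3 + a) * (3 + b) + (a * b + a + b) ≡ 2 * ((2 + a) * (2 + b)) + 1
  gap = solve-∀
  1≤gap : ∀ a b → a ≢ b → 1 ≤ a * b + a + b
  1≤gap zero    zero    a≢b = ⊥-elim (a≢b refl)
  1≤gap (suc c) b       _   = ≤-trans (s≤s z≤n) (≤-trans (m≤n+m (suc c) (suc c * b)) (m≤m+n _ b))
  1≤gap zero    (suc c) _   = s≤s z≤n

-- If (p-1)G < pX and (q-1)H < qY (here as p'G + 1 = pX, q'H + 1 = qY) and
-- pq ≤ 2(p-1)(q-1), then GH < 2XY.
deficient-product : ∀ p' q' X Y G H → p' * G + 1 ≡ suc p' * X → q' * H + 1 ≡ suc q' * Y →
                    suc p' * suc q' ≤ 2 * (p' * q') → .{{NonZero (p' * q')}} →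
                    G * H < 2 * (X * Y)
deficient-product p' q' X Y G H G≡ H≡ pq≤ = *-cancelˡ-< (p' * q') (G * H) (2 * (X * Y)) (begin-strict
  p' * q' * (G * H)                ≡⟨ regroup p' q' G H ⟩
  (p' * G) * (q' * H)              <⟨ m*n<[m+1]*[n+1] (p' * G) (q' * H) ⟩
  (p' * G + 1) * (q' * H + 1)      ≡⟨ cong₂ _*_ G≡ H≡ ⟩
  (suc p' * X) * (suc q' * Y)      ≡⟨ regroup (suc p') X (suc q') Y ⟩
  (suc p' * suc q') * (X * Y)      ≤⟨ *-monoˡ-≤ (X * Y) pq≤ ⟩
  2 * (p' * q') * (X * Y)          ≡⟨ move2 (p' * q') (X * Y) ⟩
  p' * q' * (2 * (X * Y))          ∎)
  where
  open ≤-Reasoning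
  regroup : ∀ a b c d → a * b * (c * d) ≡ (a * c) * (b * d)
  regroup = solve-∀
  move2 : ∀ m z → 2 * m * z ≡ m * (2 * z)
  move2 = solve-∀
  m*n<[m+1]*[n+1] : ∀ m n → m * n < (m + 1) * (n + 1)
  m*n<[m+1]*[n+1] m n = subst (m * n <_) (expand m n) (s≤s (m≤m+n (m * n) (m + n)))
    where
    expand : ∀ m n → suc (m * n + (m + n)) ≡ (m + 1) * (n + 1)
    expand = solve-∀

mainTheorem19 : (p₁ p₂ α β : ℕ) → Prime p₁ → Prime p₂ → p₁ ≢ p₂ →
    ¬ (2 ∣ p₁) → ¬ (2 ∣ p₂) → α > 0 → β > 0 →
    ¬ Zumkeller (p₁ ^ α * p₂ ^ β)
mainTheorem19 p₁ p₂ α β p₁-prime p₂-prime p₁≢p₂ p₁-odd p₂-odd _ _ zumkeller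
  with a , refl ← odd-prime⇒3+ p₁-prime p₁-odd
  with b , refl ← odd-prime⇒3+ p₂-prime p₂-odd
  = <⇒≱ σ<2n (zumkeller⇒2n≤σ zumkeller)
  where
  n = p₁ ^ α * p₂ ^ β
  σ<2n : sum (divisors n) < 2 * n
  σ<2n = ≤-<-trans (σ-bound p₁-prime p₂-prime α β)
    (deficient-product (2 + a) (2 + b) (p₁ ^ α) (p₂ ^ β) (sum (powers p₁ α)) (sum (powers p₂ β))
      (geometric-sum (2 + a) α) (geometric-sum (2 + b) β)
      (distinct≥3⇒pq≤2[p-1][q-1] a b (λ a≡b → p₁≢p₂ (cong (3 +_) a≡b))))
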